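{- Let $n\ge4$ and let $A$ be an $(n,1)$-matrix. Let $B=B(A)$ be indexed by $[n-1]^2$ with $B_{(i,a)(j,b)}:=A_{\overline{i+1}*\overline{a+1},\ \overline{j+1}*\overline{b+1}}$, where $\bar x=\{1,x\}$. Then for any $j\in[n-1]$ with $j>1$ the $(n-1)\times(n-1)$ block $B_{1,j}$, $(B_{1,j})_{a,b}:=B_{(1,a)(j,b)}$, is a tournament matrix.
   Context: A 1-octahedron is a pair $P_1*P_2$ of 2-element subsets of $[n]$, identified with the set of edges $(1,a)(2,b)$, $a\in P_1,b\in P_2$, of $K_{n,n}=[n]^{*2}$. An $(n,1)$-matrix is a $\mathbb{Z}_2$-matrix $A$ indexed by 1-octahedra that is symmetric, satisfies $A_{P,Q}=0$ whenever $P_1\cap Q_1=P_2\cap Q_2=\emptyset$, satisfies $A_{P,Q}=A_{X,Q}+A_{Y,Q}$ whenever $P=X\oplus Y$ (symmetric difference) for 1-octahedra $X,Y$, and satisfies $A_{\bar2*\bar2,\bar3*\bar3}+A_{\bar2*\bar3,\bar3*\bar2}=1$. A square matrix $Y$ is a tournament matrix if $Y_{a,b}+Y_{b,a}=1$ for all $a\ne b$. -}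

module Defs where

open import Data.Nat using (ℕ; zero; suc; z<s)
open import Data.Fin using (Fin; zero; suc; toℕ; _<_; _≟_)
open import Data.Product using (_×_; _,_)
open import Data.Bool using (Bool; true; false; _∧_; _∨_; _xor_)
open import Relation.Nullary using (¬_)
open import Relation.Nullary.Decidable using (⌊_⌋)
open import Relation.Binary.PropositionalEquality using (_≡_; _≢_)

-- Convention: [n] = {1,...,n} is represented by Fin n, with element x ∈ [n]
-- represented by the Fin n value x-1.  Z₂ is Bool with _xor_ as addition.

record Pair (n : ℕ) : Set where
  constructor pair
  field
    lo  : Fin n
    hi  : Fin n
    lo<hi : lo < hi
open Pair public

_∈ᵇ_ : ∀ {n} → Fin n → Pair n → Bool
x ∈ᵇ p = ⌊ x ≟ lo p ⌋ ∨ ⌊ x ≟ hi p ⌋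

Disjoint : ∀ {n} → Pair n → Pair n → Set
Disjoint P Q = ∀ x → x ∈ᵇ P ≡ true → x ∈ᵇ Q ≡ false

record Oct (n : ℕ) : Set where
  constructor _*_
  field
    side₁ : Pair n
    side₂ : Pair n
open Oct public

-- The edge (1,x)(2,y) of K_{n,n} belongs to the octahedron P.
edge : ∀ {n} → Oct n → Fin n → Fin n → Bool
edge P x y = (x ∈ᵇ side₁ P) ∧ (y ∈ᵇ side₂ P)

IsSymDiff : ∀ {n} → Oct n → Oct n → Oct n → Set
IsSymDiff P X Y = ∀ x y → edge P x y ≡ (edge X x y xor edge Y x y)

-- x̄ = {1, x} for x ∈ {2,...,n}; here the argument i : Fin m (n = suc m)
-- stands for x = i + 2, i.e. bar i = {0, suc i} in 0-based terms.
bar : ∀ {m} → Fin m → Pair (suc m)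
bar i = pair zero (suc i) z<s

OctMatrix : ℕ → Set
OctMatrix n = Oct n → Oct n → Bool

-- (n,1)-matrix, for n = 3 + k (n ≥ 3 is needed for 2̄, 3̄ to exist).
-- In bar's 0-based indexing: 2̄ = bar zero, 3̄ = bar (suc zero).
record IsN1Matrix (k : ℕ) (A : OctMatrix (suc (suc (suc k)))) : Set where
  field
    symmetric : ∀ P Q → A P Q ≡ A Q P
    vanish    : ∀ P Q → Disjoint (side₁ P) (side₁ Q) → Disjoint (side₂ P) (side₂ Q)
                → A P Q ≡ false
    additive  : ∀ P X Y Q → IsSymDiff P X Y → A P Q ≡ (A X Q xor A Y Q)
    normal    : (A (bar zero * bar zero) (bar (suc zero) * bar (suc zero))
                  xor A (bar zero * bar (suc zero)) (bar (suc zero) * bar zero)) ≡ true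

-- B(A), indexed by [n-1]² where n = suc m; index i : Fin m stands for i+1 ∈ [n-1],
-- and bar i = \overline{(i+1)+1}.
Bmat : ∀ {m} → OctMatrix (suc m) → Fin m × Fin m → Fin m × Fin m → Bool
Bmat A (i , a) (j , b) = A (bar i * bar a) (bar j * bar b)

IsTournament : ∀ {m} → (Fin m → Fin m → Bool) → Set
IsTournament {m} Y = ∀ (a b : Fin m) → a ≢ b → (Y a b xor Y b a) ≡ true

-- Write T(x,p;u,r) = A(x̄*ū, p̄*r̄) for the entry (u,r) of the block B_{x,p}, and
-- S(x,p;u,r) = T(x,p;u,r) + T(x,p;r,u); the block B_{x,p} is a tournament iff S(x,p;u,r) = 1 for u ≠ r.
-- Since x̄ ⊕ ȳ = {x,y}, additivity and the vanishing axiom make the mixed second differences of T,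
-- in (x,u) and in (x,r), vanish as long as the fixed indices p and r avoid the varied ones.
-- A function of an off-diagonal pair that is invariant under moving either coordinate is constant
-- once a third point is available (this is where n ≥ 4 is used). Applied twice, this shows that S
-- is unchanged by moving p or r; together with S(x,p;u,r) = S(x,p;r,u) = S(p,x;u,r) it follows that
-- S is constant on x ≠ p, u ≠ r, and its value at (2,3;2,3) is 1 by the normalisation axiom.
module Submission where

open import Defs
open import Data.Nat using (ℕ; suc; s<s)
open import Data.Fin using (Fin; zero; suc; _≟_; _<_)
open import Data.Fin.Properties using (<-cmp)
open import Data.Product using (_,_; _×_; ∃-syntax)
open import Data.Bool using (Bool; true; false; _∧_; _xor_)
open import Data.Bool.Properties using (xor-comm; xor-same; ∧-distribˡ-xor; ∧-distribʳ-xor)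
open import Data.Empty using (⊥-elim)
open import Relation.Binary using (Tri; tri<; tri≈; tri>)
open import Relation.Binary.PropositionalEquality
open import Relation.Nullary using (yes; no)

xor≡false⇒≡ : ∀ a b → a xor b ≡ false → a ≡ b
xor≡false⇒≡ false b e = sym e
xor≡false⇒≡ true false ()
xor≡false⇒≡ true true _ = refl

xor-transpose : ∀ a b c d → a xor b ≡ c xor d → a xor c ≡ b xor d
xor-transpose false false false false _ = refl
xor-transpose false false true  true  _ = refl
xor-transpose false true  false true  _ = refl
xor-transpose false true  true  false _ = refl
xor-transpose true  false false true  _ = refl
xor-transpose true  false true  false _ = refl
xor-transpose true  true  false false _ = refl
xor-transpose true  true  true  true  _ = refl
xor-transpose false false false true  ()
xor-transpose false false true  false ()
xor-transpose false true  false false ()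
xor-transpose false true  true  true  ()
xor-transpose true  false false false ()
xor-transpose true  false true  true  ()
xor-transpose true  true  false true  ()
xor-transpose true  true  true  false ()

Disjoint-sym : ∀ {n} {P Q : Pair n} → Disjoint P Q → Disjoint Q P
Disjoint-sym {P = P} P∩Q=∅ z z∈Q with z ∈ᵇ P in z∈P
... | false = refl
... | true  = trans (sym z∈Q) (P∩Q=∅ z z∈P)

symDiff-side₁ : ∀ {n} (S X Y T : Pair n) → (∀ z → z ∈ᵇ S ≡ (z ∈ᵇ X xor z ∈ᵇ Y)) →
                IsSymDiff (S * T) (X * T) (Y * T)
symDiff-side₁ S X Y T S=X⊕Y z w =
  trans (cong (_∧ w ∈ᵇ T) (S=X⊕Y z)) (∧-distribʳ-xor (w ∈ᵇ T) (z ∈ᵇ X) (z ∈ᵇ Y))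

symDiff-side₂ : ∀ {n} (S X Y T : Pair n) → (∀ w → w ∈ᵇ S ≡ (w ∈ᵇ X xor w ∈ᵇ Y)) →
                IsSymDiff (T * S) (T * X) (T * Y)
symDiff-side₂ S X Y T S=X⊕Y z w =
  trans (cong (z ∈ᵇ T ∧_) (S=X⊕Y w)) (∧-distribˡ-xor (z ∈ᵇ T) (w ∈ᵇ X) (w ∈ᵇ Y))

module _ {m : ℕ} where

  sucPair : ∀ {x y : Fin m} → Tri (x < y) (x ≡ y) (y < x) → x ≢ y → Pair (suc m)
  sucPair {x} {y} (tri< x<y _ _) _   = pair (suc x) (suc y) (s<s x<y)
  sucPair         (tri≈ _ x≡y _) x≢y = ⊥-elim (x≢y x≡y)
  sucPair {x} {y} (tri> _ _ y<x) _   = pair (suc y) (suc x) (s<s y<x)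

  -- The symmetric difference x̄ ⊕ ȳ: the common point 1 of x̄ and ȳ cancels.
  barSum : (x y : Fin m) → x ≢ y → Pair (suc m)
  barSum x y = sucPair (<-cmp x y)

  ∈-sucPair : ∀ {x y : Fin m} (x≢y : x ≢ y) (lt : suc x < suc y) z →
              z ∈ᵇ pair (suc x) (suc y) lt ≡ (z ∈ᵇ bar x xor z ∈ᵇ bar y)
  ∈-sucPair x≢y lt zero = refl
  ∈-sucPair {x} {y} x≢y lt (suc z) with z ≟ x | z ≟ y
  ... | yes refl | yes refl = ⊥-elim (x≢y refl)
  ... | yes _    | no _     = refl
  ... | no _     | yes _    = refl
  ... | no _     | no _     = refl

  ∈-barSum : ∀ {x y : Fin m} (x≢y : x ≢ y) z → z ∈ᵇ barSum x y x≢y ≡ (z ∈ᵇ bar x xor z ∈ᵇ bar y)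
  ∈-barSum {x} {y} x≢y z = ∈-ordered (<-cmp x y)
    where
    ∈-ordered : (t : Tri (x < y) (x ≡ y) (y < x)) → z ∈ᵇ sucPair t x≢y ≡ (z ∈ᵇ bar x xor z ∈ᵇ bar y)
    ∈-ordered (tri< x<y _ _) = ∈-sucPair x≢y (s<s x<y) z
    ∈-ordered (tri≈ _ x≡y _) = ⊥-elim (x≢y x≡y)
    ∈-ordered (tri> _ _ y<x) =
      trans (∈-sucPair (≢-sym x≢y) (s<s y<x) z) (xor-comm (z ∈ᵇ bar y) (z ∈ᵇ bar x))

  suc∉bar : ∀ {p x : Fin m} → p ≢ x → suc p ∈ᵇ bar x ≡ false
  suc∉bar {p} {x} p≢x with p ≟ x
  ... | yes p≡x = ⊥-elim (p≢x p≡x)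
  ... | no _    = refl

  barSum-symDiff₁ : ∀ {x y : Fin m} (x≢y : x ≢ y) T →
                    IsSymDiff (barSum x y x≢y * T) (bar x * T) (bar y * T)
  barSum-symDiff₁ {x} {y} x≢y T = symDiff-side₁ (barSum x y x≢y) (bar x) (bar y) T (∈-barSum x≢y)

  barSum-symDiff₂ : ∀ {x y : Fin m} (x≢y : x ≢ y) T →
                    IsSymDiff (T * barSum x y x≢y) (T * bar x) (T * bar y)
  barSum-symDiff₂ {x} {y} x≢y T = symDiff-side₂ (barSum x y x≢y) (bar x) (bar y) T (∈-barSum x≢y)

  bar-disjoint-barSum : ∀ {p x y : Fin m} (x≢y : x ≢ y) → p ≢ x → p ≢ y →
                        Disjoint (bar p) (barSum x y x≢y)
  bar-disjoint-barSum x≢y p≢x p≢y zero _ = ∈-barSum x≢y zero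
  bar-disjoint-barSum {p} x≢y p≢x p≢y (suc z) z∈p̄ with z ≟ p | z∈p̄
  ... | yes refl | _ = trans (∈-barSum x≢y (suc z)) (cong₂ _xor_ (suc∉bar p≢x) (suc∉bar p≢y))
  ... | no _     | ()

  barSum-disjoint-bar : ∀ {p x y : Fin m} (x≢y : x ≢ y) → p ≢ x → p ≢ y →
                        Disjoint (barSum x y x≢y) (bar p)
  barSum-disjoint-bar {p} {x} {y} x≢y p≢x p≢y =
    Disjoint-sym {P = bar p} {Q = barSum x y x≢y} (bar-disjoint-barSum x≢y p≢x p≢y)

module _ {a ℓ} {X : Set a} {Y : Set ℓ} (f : X → X → Y)
         (moveˡ : ∀ {x x′ y} → y ≢ x → y ≢ x′ → f x y ≡ f x′ y)
         (moveʳ : ∀ {x y y′} → x ≢ y → x ≢ y′ → f x y ≡ f x y′) where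

  offDiagonal-constant : ∀ {x y x′ y′} → x ≢ y → x′ ≢ y′ → ∃[ z ] z ≢ y × z ≢ y′ → f x y ≡ f x′ y′
  offDiagonal-constant x≢y x′≢y′ (_ , z≢y , z≢y′) =
    trans (moveˡ (≢-sym x≢y) (≢-sym z≢y))
      (trans (moveʳ z≢y z≢y′) (sym (moveˡ (≢-sym x′≢y′) (≢-sym z≢y′))))

MixedVanishes : ∀ {m} → (Fin m → Fin m → Bool) → (x y u v : Fin m) → Set
MixedVanishes g x y u v = (g x u xor g x v) ≡ (g y u xor g y v)

mixedVanishes-fromDistinct : ∀ {m} (g : Fin m → Fin m → Bool) {x y u v} →
                             (x ≢ y → u ≢ v → MixedVanishes g x y u v) → MixedVanishes g x y u v
mixedVanishes-fromDistinct g {x} {y} {u} {v} distinct with x ≟ y | u ≟ v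
... | yes refl | _        = refl
... | no _     | yes refl = trans (xor-same (g x u)) (sym (xor-same (g y u)))
... | no x≢y   | no u≢v   = distinct x≢y u≢v

module N1Matrix {k : ℕ} {A : OctMatrix (suc (suc (suc k)))} (M : IsN1Matrix k A) where
  open IsN1Matrix M
  open ≡-Reasoning

  additiveʳ : ∀ P {Q X Y} → IsSymDiff Q X Y → A P Q ≡ (A P X xor A P Y)
  additiveʳ P {Q} {X} {Y} Q=X⊕Y =
    trans (symmetric P Q) (trans (additive Q X Y P Q=X⊕Y) (cong₂ _xor_ (symmetric X P) (symmetric Y P)))

  block : (x p u r : Fin (suc (suc k))) → Bool
  block x p u r = Bmat A (x , u) (p , r)

  block-sym : ∀ x p u r → block x p u r ≡ block p x r u
  block-sym x p u r = symmetric _ _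

  block-rowMixed : ∀ {x y u v p r} → p ≢ x → p ≢ y → r ≢ u → r ≢ v →
                   MixedVanishes (λ x u → block x p u r) x y u v
  block-rowMixed {x} {y} {u} {v} {p} {r} p≢x p≢y r≢u r≢v =
    mixedVanishes-fromDistinct (λ x u → block x p u r) {x} {y} {u} {v} λ x≢y u≢v →
      let U = barSum u v u≢v
          Q = bar p * bar r
      in xor≡false⇒≡ _ _ (begin
        (block x p u r xor block x p v r) xor (block y p u r xor block y p v r)
          ≡⟨ sym (cong₂ _xor_ (additive _ _ _ Q (barSum-symDiff₂ u≢v (bar x)))
                              (additive _ _ _ Q (barSum-symDiff₂ u≢v (bar y)))) ⟩
        A (bar x * U) Q xor A (bar y * U) Q
          ≡⟨ sym (additive _ _ _ Q (barSum-symDiff₁ x≢y U)) ⟩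
        A (barSum x y x≢y * U) Q
          ≡⟨ vanish (barSum x y x≢y * U) Q (barSum-disjoint-bar x≢y p≢x p≢y)
                                           (barSum-disjoint-bar u≢v r≢u r≢v) ⟩
        false ∎)

  block-crossMixed : ∀ {x y u v p r} → p ≢ x → p ≢ y → r ≢ u → r ≢ v →
                     MixedVanishes (λ x u → block x p r u) x y u v
  block-crossMixed {x} {y} {u} {v} {p} {r} p≢x p≢y r≢u r≢v =
    mixedVanishes-fromDistinct (λ x u → block x p r u) {x} {y} {u} {v} λ x≢y u≢v →
      let V = barSum u v u≢v
          Q = bar p * V
      in xor≡false⇒≡ _ _ (begin
        (block x p r u xor block x p r v) xor (block y p r u xor block y p r v)
          ≡⟨ sym (cong₂ _xor_ (additiveʳ (bar x * bar r) (barSum-symDiff₂ u≢v (bar p)))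
                              (additiveʳ (bar y * bar r) (barSum-symDiff₂ u≢v (bar p)))) ⟩
        A (bar x * bar r) Q xor A (bar y * bar r) Q
          ≡⟨ sym (additive _ _ _ Q (barSum-symDiff₁ x≢y (bar r))) ⟩
        A (barSum x y x≢y * bar r) Q
          ≡⟨ vanish (barSum x y x≢y * bar r) Q (barSum-disjoint-bar x≢y p≢x p≢y)
                                              (bar-disjoint-barSum u≢v r≢u r≢v) ⟩
        false ∎)

  symSum : (x p u r : Fin (suc (suc k))) → Bool
  symSum x p u r = block x p u r xor block x p r u

  symSum-swapEntries : ∀ x p u r → symSum x p u r ≡ symSum x p r u
  symSum-swapEntries x p u r = xor-comm (block x p u r) (block x p r u)

  symSum-swapBlocks : ∀ x p u r → symSum x p u r ≡ symSum p x u r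
  symSum-swapBlocks x p u r =
    trans (symSum-swapEntries x p u r) (cong₂ _xor_ (block-sym x p r u) (block-sym x p u r))

  symSum-moveBlock : ∀ {x p p′ u r} → x ≢ p → x ≢ p′ → u ≢ r → ∃[ s ] s ≢ u × s ≢ r →
                   symSum x p u r ≡ symSum x p′ u r
  symSum-moveBlock {x} {p} {p′} {u} {r} x≢p x≢p′ u≢r third =
    xor-transpose (block x p u r) (block x p′ u r) (block x p r u) (block x p′ r u) (begin
      block x p u r xor block x p′ u r  ≡⟨ cong₂ _xor_ (block-sym x p u r) (block-sym x p′ u r) ⟩
      D r u                             ≡⟨ offDiagonal-constant D D-moveˡ D-moveʳ (≢-sym u≢r) u≢r third ⟩
      D u r                             ≡⟨ sym (cong₂ _xor_ (block-sym x p r u) (block-sym x p′ r u)) ⟩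
      block x p r u xor block x p′ r u  ∎)
    where
    D : (a b : Fin (suc (suc k))) → Bool
    D a b = block p x a b xor block p′ x a b

    D-moveˡ : ∀ {a a′ b} → b ≢ a → b ≢ a′ → D a b ≡ D a′ b
    D-moveˡ {a} {a′} {b} b≢a b≢a′ =
      xor-transpose (block p x a b) (block p x a′ b) (block p′ x a b) (block p′ x a′ b)
        (block-rowMixed x≢p x≢p′ b≢a b≢a′)

    D-moveʳ : ∀ {a b b′} → a ≢ b → a ≢ b′ → D a b ≡ D a b′
    D-moveʳ {a} {b} {b′} a≢b a≢b′ =
      xor-transpose (block p x a b) (block p x a b′) (block p′ x a b) (block p′ x a b′)
        (block-crossMixed x≢p x≢p′ a≢b a≢b′)

  symSum-moveEntry : ∀ {x p u r r′} → u ≢ r → u ≢ r′ → x ≢ p → ∃[ y ] y ≢ p × y ≢ x →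
                   symSum x p u r ≡ symSum x p u r′
  symSum-moveEntry {x} {p} {u} {r} {r′} u≢r u≢r′ x≢p third =
    xor-transpose (block x p u r) (block x p u r′) (block x p r u) (block x p r′ u) (begin
      E x p                              ≡⟨ offDiagonal-constant E E-moveˡ E-moveʳ x≢p (≢-sym x≢p) third ⟩
      E p x                              ≡⟨ cong₂ _xor_ (block-sym p x u r) (block-sym p x u r′) ⟩
      block x p r u xor block x p r′ u   ∎)
    where
    E : (a b : Fin (suc (suc k))) → Bool
    E a b = block a b u r xor block a b u r′

    E-moveˡ : ∀ {a a′ b} → b ≢ a → b ≢ a′ → E a b ≡ E a′ b
    E-moveˡ b≢a b≢a′ = block-crossMixed b≢a b≢a′ u≢r u≢r′

    E-moveʳ : ∀ {a b b′} → a ≢ b → a ≢ b′ → E a b ≡ E a b′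
    E-moveʳ {a} {b} {b′} a≢b a≢b′ = begin
      E a b                                ≡⟨ cong₂ _xor_ (block-sym a b u r) (block-sym a b u r′) ⟩
      block b a r u xor block b a r′ u     ≡⟨ block-rowMixed a≢b a≢b′ u≢r u≢r′ ⟩
      block b′ a r u xor block b′ a r′ u   ≡⟨ sym (cong₂ _xor_ (block-sym a b′ u r) (block-sym a b′ u r′)) ⟩
      E a b′                               ∎

fin-third : ∀ {k} (a b : Fin (suc (suc (suc k)))) → ∃[ c ] c ≢ a × c ≢ b
fin-third zero                zero                = suc zero , (λ ()) , (λ ())
fin-third zero                (suc zero)          = suc (suc zero) , (λ ()) , (λ ())
fin-third zero                (suc (suc _))       = suc zero , (λ ()) , (λ ())
fin-third (suc zero)          zero                = suc (suc zero) , (λ ()) , (λ ())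
fin-third (suc (suc _))       zero                = suc zero , (λ ()) , (λ ())
fin-third (suc _)             (suc _)             = zero , (λ ()) , (λ ())

module _ {k : ℕ} {A : OctMatrix (suc (suc (suc (suc k))))} (M : IsN1Matrix (suc k) A) where
  open N1Matrix M
  open IsN1Matrix M using (normal)

  symSum-constant : ∀ {x p u r} → x ≢ p → u ≢ r →
                    symSum x p u r ≡ symSum zero (suc zero) zero (suc zero)
  symSum-constant {u = u} {r} x≢p u≢r =
    trans (offDiagonal-constant (λ x p → symSum x p u r) moveBlockˡ moveBlockʳ
             x≢p (λ ()) (fin-third _ _))
          (offDiagonal-constant (λ u r → symSum zero (suc zero) u r) moveEntryˡ moveEntryʳ
             u≢r (λ ()) (fin-third _ _))
    where
    moveBlockʳ : ∀ {x p p′} → x ≢ p → x ≢ p′ → symSum x p u r ≡ symSum x p′ u r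
    moveBlockʳ x≢p x≢p′ = symSum-moveBlock x≢p x≢p′ u≢r (fin-third u r)

    moveBlockˡ : ∀ {x x′ p} → p ≢ x → p ≢ x′ → symSum x p u r ≡ symSum x′ p u r
    moveBlockˡ {x} {x′} {p} p≢x p≢x′ =
      trans (symSum-swapBlocks x p u r)
        (trans (moveBlockʳ p≢x p≢x′) (sym (symSum-swapBlocks x′ p u r)))

    moveEntryʳ : ∀ {u r r′} → u ≢ r → u ≢ r′ → symSum zero (suc zero) u r ≡ symSum zero (suc zero) u r′
    moveEntryʳ u≢r u≢r′ = symSum-moveEntry u≢r u≢r′ (λ ()) (fin-third _ _)

    moveEntryˡ : ∀ {u u′ r} → r ≢ u → r ≢ u′ → symSum zero (suc zero) u r ≡ symSum zero (suc zero) u′ r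
    moveEntryˡ {u} {u′} {r} r≢u r≢u′ =
      trans (symSum-swapEntries _ _ u r)
        (trans (moveEntryʳ r≢u r≢u′) (sym (symSum-swapEntries _ _ u′ r)))

  offDiagonalBlock-isTournament : ∀ {x p} → x ≢ p → IsTournament (λ a b → Bmat A (x , a) (p , b))
  offDiagonalBlock-isTournament x≢p u r u≢r = trans (symSum-constant x≢p u≢r) normal

lemma3p5 : (k : ℕ) (A : OctMatrix (suc (suc (suc (suc k))))) → IsN1Matrix (suc k) A
    → (j : Fin (suc (suc k))) → IsTournament (λ a b → Bmat A (zero , a) (suc j , b))
lemma3p5 k A M j = offDiagonalBlock-isTournament M (λ ())
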